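{- Let $0<\alpha<1$. Then the Chebyshev polynomial hypergroup of the second kind is not an $\alpha$-Ramsey hypergroup.
   Context: The Chebyshev polynomial hypergroup of the second kind is $\mathbb{Z}_+$ with identity $0$, identity involution, and convolution $\delta_m*\delta_n=\sum_{k=0}^{\min\{m,n\}}\frac{|m-n|+2k+1}{(m+1)(n+1)}\delta_{|m-n|+2k}$ (extended bilinearly). For an infinite discrete hypergroup $K$ with identity $e$, an injective sequence $\langle x_n\rangle$ in $K\setminus\{e\}$ with range $B$, and nonempty finite $F=\{x_{n_1},\dots,x_{n_m}\}\subset B$ with $n_1<\dots<n_m$, put $\delta_F=\delta_{x_{n_1}}*\cdots*\delta_{x_{n_m}}$. For $0\le\alpha<1$, $K$ is an $\alpha$-Ramsey hypergroup if for every finite partition $K=\bigcup_{i=1}^rC_i$ there exist $i$ and an injective sequence $\langle x_n\rangle$ in $K\setminus\{e\}$ with range $B$ such that $\delta_F(C_i)>\alpha$ for every nonempty finite $F\subset B$.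
   Formalization: The parameter α ranges only over rationals with $0<\alpha<1$ rather than over all reals in that interval. -}

module Defs where

open import Data.Nat as ℕ using (ℕ; zero; suc; _+_; _⊓_; ∣_-_∣)
open import Data.Integer using (+_)
open import Data.Rational as ℚ using (ℚ; _/_; 0ℚ; 1ℚ)
open import Data.Fin using (Fin; _≟_)
open import Data.List using (List; []; _∷_; map; concatMap; upTo; foldl)
open import Data.List.Relation.Unary.Linked using (Linked)
open import Data.Product using (_×_; _,_; ∃)
open import Function.Definitions using (Injective)
open import Relation.Binary.PropositionalEquality using (_≡_; _≢_)
open import Relation.Nullary using (yes; no)

-- A finitely supported (signed-free) measure on ℤ₊ = ℕ, as a list of
-- (point, weight) pairs; the measure of a set is the sum of the weights
-- of entries whose point lies in the set (repetitions add up).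
Measure : Set
Measure = List (ℕ × ℚ)

δ : ℕ → Measure
δ x = (x , 1ℚ) ∷ []

-- δ_m * δ_n = Σ_{k=0}^{min(m,n)} (|m-n|+2k+1)/((m+1)(n+1)) δ_{|m-n|+2k}
convδ : ℕ → ℕ → Measure
convδ m n = map (λ k → (∣ m - n ∣ + 2 ℕ.* k ,
                        (+ (∣ m - n ∣ + 2 ℕ.* k + 1)) / (suc m ℕ.* suc n)))
                (upTo (suc (m ⊓ n)))

_⋆_ : Measure → Measure → Measure
μ ⋆ ν = concatMap (λ { (a , p) → concatMap (λ { (b , q) →
          map (λ { (c , w) → (c , p ℚ.* q ℚ.* w) }) (convδ a b) }) ν }) μ

-- measure of the colour class C_i = { k | col k ≡ i } of a colouring
-- col : ℕ → Fin r (a finite partition of ℕ into r classes)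
massIn : ∀ {r} → Measure → (ℕ → Fin r) → Fin r → ℚ
massIn [] col i = 0ℚ
massIn ((a , w) ∷ μ) col i with col a ≟ i
... | yes _ = w ℚ.+ massIn μ col i
... | no  _ = massIn μ col i

-- δ_F for F = {x n₁, …, x n_m} with indices given as the nonempty
-- list n₁ ∷ ns (required strictly increasing):
-- δ_F = δ_{x n₁} * δ_{x n₂} * ⋯ * δ_{x n_m}
δF : (ℕ → ℕ) → ℕ → List ℕ → Measure
δF x n ns = foldl (λ μ j → μ ⋆ δ (x j)) (δ (x n)) ns

IsRamsey : ℚ → Set
IsRamsey α =
  ∀ (r : ℕ) (col : ℕ → Fin r) →
  ∃ λ (i : Fin r) → ∃ λ (x : ℕ → ℕ) →
    Injective _≡_ _≡_ x × (∀ n → x n ≢ 0) ×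
    (∀ (n : ℕ) (ns : List ℕ) → Linked ℕ._<_ (n ∷ ns) →
       α ℚ.< massIn (δF x n ns) col i)

module Submission where

-- Write α = (k+1)/(N+1) and P = 4(N+1), and colour ℕ by
-- c(v) = ⌊v/2⌋ mod P.  We show that for m, n ≥ P every colour class C
-- satisfies (δ_m * δ_n)(C) ≤ 1/(N+1) ≤ α; since an injective sequence is
-- unbounded, any would-be Ramsey sequence has terms x_a, x_b ≥ P with a < b,
-- and F = {x_a, x_b} then violates δ_F(C_i) > α.
--   * δ_m * δ_n lives on the progression d, d+2, …, d+2s (d = |m-n|,
--     s = min(m,n)), the point v carrying weight (v+1)/((m+1)(n+1)).
--   * Along a step-2 progression ⌊v/2⌋ grows by one per step, so a class of c
--     meets any P consecutive terms at most once (c is "P-sparse").  Cutting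
--     the s+1 terms into blocks of length P gives the block bound
--     P · Σ_{v ∈ C} (v+1) ≤ (s+1+P)(d+2s+2), which is ≤ 4(m+1)(n+1) once s ≥ P.
-- The file develops, in order: progressions, the weighted hit sum of a colour
-- class and its mass, the block bound for sparse colourings, sparseness of
-- ⌊v/2⌋ mod P, the support of δ_m * δ_n, unboundedness of injective
-- sequences, the two-point estimate, and finally the theorem.

open import Defs
open import Data.Rational using (ℚ; 0ℚ; 1ℚ; _<_)
open import Relation.Nullary using (¬_)

open import Data.Nat as ℕ using (ℕ; zero; suc; _+_; _*_; _≤_; z≤n; s≤s; _%_; _≤?_; _⊓_; _⊔_; ∣_-_∣; ⌊_/2⌋; NonZero)
open import Data.Nat.Properties hiding (_≟_)
open import Data.Nat.DivMod using (_mod_; m≡m%n+[m/n]*n)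
open import Data.Nat.Divisibility using (_∣_; ∣m+n∣m⇒∣n; ∣⇒≤; n∣m*n)
open import Data.Nat.Induction using (<-wellFounded)
open import Data.Nat.Tactic.RingSolver using (solve-∀)
open import Data.Fin using (Fin; toℕ; _≟_; fromℕ<)
open import Data.Fin.Properties using (toℕ-fromℕ<; fromℕ<-injective; any?; pigeonhole)
open import Data.Empty using (⊥-elim)
open import Data.Sum using (inj₁; inj₂)
open import Data.Product using (_×_; _,_; ∃; proj₁; proj₂)
open import Data.List using (List; []; _∷_; map; applyUpTo; _++_)
open import Data.List.Properties using (++-identityʳ; map-cong; map-id)
open import Data.List.Relation.Unary.Linked using ([-]; _∷_)
open import Data.Integer as ℤ using (ℤ; +_; -[1+_])
open import Data.Integer.Properties using (pos-*)
import Data.Integer.Tactic.RingSolver as ℤ-Solver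
import Data.Rational as Q
import Data.Rational.Properties as QP
open import Data.Rational.Unnormalised as U using (mkℚᵘ; *≡*; *≤*)
import Data.Rational.Unnormalised.Properties as UP
open import Function using (_∘_)
open import Function.Definitions using (Injective)
open import Induction.WellFounded using (Acc; acc)
open import Relation.Nullary using (yes; no)
open import Relation.Binary.PropositionalEquality

step-right : ∀ q j → q + 2 * suc j ≡ q + 2 * j + 2
step-right = solve-∀

step-left : ∀ q j → q + 2 + 2 * j ≡ q + 2 * suc j
step-left = solve-∀

progression : ℕ → ℕ → List ℕ
progression q zero    = []
progression q (suc t) = q ∷ progression (q + 2) t

progression-++ : ∀ q a t → progression q (a + t) ≡ progression q a ++ progression (q + 2 * a) t
progression-++ q zero    t = cong (λ z → progression z t) (sym (+-identityʳ q))
progression-++ q (suc a) t = cong (q ∷_) (trans (progression-++ (q + 2) a t)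
  (cong (λ z → progression (q + 2) a ++ progression z t) (step-left q a)))

applyUpTo-progression : ∀ (f : ℕ → ℕ) q t → (∀ k → f k ≡ q + 2 * k) → applyUpTo f t ≡ progression q t
applyUpTo-progression f q zero    f≡ = refl
applyUpTo-progression f q (suc t) f≡ = cong₂ _∷_ (trans (f≡ 0) (+-identityʳ q))
  (applyUpTo-progression (f ∘ suc) (q + 2) t (λ k → trans (f≡ (suc k)) (sym (step-left q k))))

map-applyUpTo : ∀ {A B : Set} (g : A → B) (f : ℕ → A) t → map g (applyUpTo f t) ≡ applyUpTo (g ∘ f) t
map-applyUpTo g f zero    = refl
map-applyUpTo g f (suc t) = cong (g (f 0) ∷_) (map-applyUpTo g (f ∘ suc) t)

-- The atom v with weight (v+1)/(B+1): the shape of every atom of δ_m * δ_n.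
weighted : ℕ → ℕ → ℕ × ℚ
weighted B v = (v , (+ (v + 1)) Q./ suc B)

+-same-denominator : ∀ a c B → mkℚᵘ (+ a) B U.+ mkℚᵘ (+ c) B U.≃ mkℚᵘ (+ (a + c)) B
+-same-denominator a c B = *≡* (identity (+ a) (+ c) (+ suc B))
  where
  identity : ∀ (x z y : ℤ) → (x ℤ.* y ℤ.+ z ℤ.* y) ℤ.* y ≡ (x ℤ.+ z) ℤ.* (y ℤ.* y)
  identity = ℤ-Solver.solve-∀

fraction-≤ : ∀ {a b c e} → a * suc e ≤ c * suc b → mkℚᵘ (+ a) b U.≤ mkℚᵘ (+ c) e
fraction-≤ {a} {b} {c} {e} le = *≤* (subst₂ ℤ._≤_ (pos-* a (suc e)) (pos-* c (suc b)) (ℤ.+≤+ le))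

module ColourClass {r} (c : ℕ → Fin r) (i : Fin r) where

  hitSum : List ℕ → ℕ
  hitSum []       = 0
  hitSum (v ∷ vs) with c v ≟ i
  ... | yes _ = v + 1 + hitSum vs
  ... | no  _ = hitSum vs

  hitSum-++ : ∀ us vs → hitSum (us ++ vs) ≡ hitSum us + hitSum vs
  hitSum-++ []       vs = refl
  hitSum-++ (u ∷ us) vs with c u ≟ i
  ... | yes _ = trans (cong (λ z → u + 1 + z) (hitSum-++ us vs)) (sym (+-assoc (u + 1) (hitSum us) (hitSum vs)))
  ... | no  _ = hitSum-++ us vs

  mass-weighted : ∀ B vs → Q.toℚᵘ (massIn (map (weighted B) vs) c i) U.≃ mkℚᵘ (+ hitSum vs) B
  mass-weighted B []       = *≡* refl
  mass-weighted B (v ∷ vs) with c v ≟ i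
  ... | no  _ = mass-weighted B vs
  ... | yes _ = begin
    Q.toℚᵘ (w Q.+ rest)                        ≈⟨ QP.toℚᵘ-homo-+ w rest ⟩
    Q.toℚᵘ w U.+ Q.toℚᵘ rest                   ≈⟨ UP.+-cong (QP.toℚᵘ-fromℚᵘ (mkℚᵘ (+ (v + 1)) B)) (mass-weighted B vs) ⟩
    mkℚᵘ (+ (v + 1)) B U.+ mkℚᵘ (+ hitSum vs) B ≈⟨ +-same-denominator (v + 1) (hitSum vs) B ⟩
    mkℚᵘ (+ (v + 1 + hitSum vs)) B             ∎
    where
    open UP.≃-Reasoning
    w    = (+ (v + 1)) Q./ suc B
    rest = massIn (map (weighted B) vs) c i

  Sparse : ℕ → Set
  Sparse P = ∀ q j → c q ≡ i → 0 ℕ.< j → j ℕ.< P → c (q + 2 * j) ≢ i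

  module Blocks (P : ℕ) .{{_ : NonZero P}} (sparse : Sparse P) where

    misses-after-hit : ∀ {q} → c q ≡ i → ∀ j t → 0 ℕ.< j → j + t ≤ P → hitSum (progression (q + 2 * j) t) ≡ 0
    misses-after-hit cq j zero    _   _     = refl
    misses-after-hit {q} cq j (suc t) 0<j j+t≤P with c (q + 2 * j) ≟ i
    ... | yes hit = ⊥-elim (sparse q j cq 0<j (≤-trans (m<m+n j (s≤s z≤n)) j+t≤P) hit)
    ... | no  _   = subst (λ z → hitSum (progression z t) ≡ 0) (step-right q j)
                      (misses-after-hit cq (suc j) t (s≤s z≤n) (subst (_≤ P) (+-suc j t) j+t≤P))

    -- A window of at most P terms contains at most one hit, of weight < q + 2t.
    window : ∀ q t → t ≤ P → hitSum (progression q t) ≤ q + 2 * t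
    window q zero    _   = z≤n
    window q (suc t) 1+t≤P with c q ≟ i
    ... | yes cq = begin
      q + 1 + hitSum (progression (q + 2) t) ≡⟨ cong (λ z → q + 1 + z) (misses-after-hit cq 1 t (s≤s z≤n) 1+t≤P) ⟩
      q + 1 + 0                              ≡⟨ +-identityʳ (q + 1) ⟩
      q + 1                                  ≤⟨ +-monoʳ-≤ q (s≤s z≤n) ⟩
      q + 2 * suc t                          ∎
      where open ≤-Reasoning
    ... | no  _  = ≤-trans (window (q + 2) t (≤-trans (n≤1+n t) 1+t≤P)) (≤-reflexive (step-left q t))

    block-step : ∀ q t → P * hitSum (progression (q + 2 * P) t) ≤ (t + P) * (q + 2 * P + 2 * t) →
                 P * hitSum (progression q (P + t)) ≤ (P + t + P) * (q + 2 * (P + t))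
    block-step q t rest = begin
      P * hitSum (progression q (P + t))                 ≡⟨ cong (λ vs → P * hitSum vs) (progression-++ q P t) ⟩
      P * hitSum (progression q P ++ progression q′ t)    ≡⟨ cong (P *_) (hitSum-++ (progression q P) _) ⟩
      P * (hitSum (progression q P) + hitSum (progression q′ t)) ≡⟨ *-distribˡ-+ P _ _ ⟩
      P * hitSum (progression q P) + P * hitSum (progression q′ t)
        ≤⟨ +-mono-≤ (*-monoʳ-≤ P (≤-trans (window q P ≤-refl) q′≤M)) (≤-trans rest (≤-reflexive (cong ((t + P) *_) q′+2t≡M))) ⟩
      P * M + (t + P) * M                                 ≡⟨ collect P t M ⟩
      (P + t + P) * M                                     ∎
      where
      open ≤-Reasoning
      q′ = q + 2 * P
      M  = q + 2 * (P + t)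
      q′+2t≡M : q′ + 2 * t ≡ M
      q′+2t≡M = regroup q P t
        where
        regroup : ∀ q P t → q + 2 * P + 2 * t ≡ q + 2 * (P + t)
        regroup = solve-∀
      q′≤M : q′ ≤ M
      q′≤M = ≤-trans (m≤m+n q′ (2 * t)) (≤-reflexive q′+2t≡M)
      collect : ∀ P t M → P * M + (t + P) * M ≡ (P + t + P) * M
      collect = solve-∀

    -- Block bound: a class receives at most ⌈t/P⌉ ≤ (t+P)/P hits, each of weight ≤ q + 2t.
    bound : ∀ q t → P * hitSum (progression q t) ≤ (t + P) * (q + 2 * t)
    bound q t = blocks t (<-wellFounded t) q
      where
      blocks : ∀ t → Acc ℕ._<_ t → ∀ q → P * hitSum (progression q t) ≤ (t + P) * (q + 2 * t)
      blocks t (acc smaller) q with t ≤? P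
      ... | yes t≤P = ≤-trans (*-monoʳ-≤ P (window q t t≤P)) (*-monoˡ-≤ (q + 2 * t) (m≤n+m P t))
      ... | no  t≰P with m≤n⇒∃[o]m+o≡n (<⇒≤ (≰⇒> t≰P))
      ...   | t′ , refl = block-step q t′ (blocks t′ (smaller (m<n+m t′ (ℕ.>-nonZero⁻¹ P))) (q + 2 * P))

half-shift : ∀ q j → ⌊ q + 2 * j /2⌋ ≡ ⌊ q /2⌋ + j
half-shift q zero    = trans (cong ⌊_/2⌋ (+-identityʳ q)) (sym (+-identityʳ ⌊ q /2⌋))
half-shift q (suc j) = begin
  ⌊ q + 2 * suc j /2⌋   ≡⟨ cong ⌊_/2⌋ (trans (step-right q j) (+-comm (q + 2 * j) 2)) ⟩
  suc ⌊ q + 2 * j /2⌋   ≡⟨ cong suc (half-shift q j) ⟩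
  suc (⌊ q /2⌋ + j)     ≡⟨ sym (+-suc ⌊ q /2⌋ j) ⟩
  ⌊ q /2⌋ + suc j       ∎
  where open ≡-Reasoning

residue-shift : ∀ P .{{_ : NonZero P}} h j → 0 ℕ.< j → j ℕ.< P → (h + j) % P ≢ h % P
residue-shift P h j 0<j j<P same = <⇒≱ j<P (∣⇒≤ {{ℕ.>-nonZero 0<j}} P∣j)
  where
  open ≡-Reasoning
  A = (h + j) ℕ./ P
  B = h ℕ./ P
  quotients : B * P + j ≡ A * P
  quotients = +-cancelˡ-≡ (h % P) (B * P + j) (A * P) (begin
    h % P + (B * P + j) ≡⟨ sym (+-assoc (h % P) (B * P) j) ⟩
    h % P + B * P + j   ≡⟨ cong (_+ j) (sym (m≡m%n+[m/n]*n h P)) ⟩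
    h + j               ≡⟨ m≡m%n+[m/n]*n (h + j) P ⟩
    (h + j) % P + A * P ≡⟨ cong (_+ A * P) same ⟩
    h % P + A * P       ∎)
  P∣j : P ∣ j
  P∣j = ∣m+n∣m⇒∣n (subst (P ∣_) (sym quotients) (n∣m*n A)) (n∣m*n B)

halfResidue : (P : ℕ) .{{_ : NonZero P}} → ℕ → Fin P
halfResidue P v = ⌊ v /2⌋ mod P

-- Every class of c_P is P-sparse: ⌊·/2⌋ runs through P consecutive integers.
halfResidue-sparse : ∀ P .{{_ : NonZero P}} (i : Fin P) → ColourClass.Sparse (halfResidue P) i P
halfResidue-sparse P i q j cq 0<j j<P cqj = residue-shift P ⌊ q /2⌋ j 0<j j<P (begin
  (⌊ q /2⌋ + j) % P          ≡⟨ cong (_% P) (sym (half-shift q j)) ⟩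
  ⌊ q + 2 * j /2⌋ % P        ≡⟨ sym (toℕ-fromℕ< _) ⟩
  toℕ (halfResidue P (q + 2 * j)) ≡⟨ cong toℕ (trans cqj (sym cq)) ⟩
  toℕ (halfResidue P q)      ≡⟨ toℕ-fromℕ< _ ⟩
  ⌊ q /2⌋ % P                ∎)
  where open ≡-Reasoning

δ-⋆-δ : ∀ m n → δ m ⋆ δ n ≡ convδ m n
δ-⋆-δ m n = trans (++-identityʳ _) (trans (++-identityʳ _)
  (trans (map-cong unit-weight (convδ m n)) (map-id (convδ m n))))
  where
  unit-weight : ∀ (a : ℕ × ℚ) → (proj₁ a , 1ℚ Q.* 1ℚ Q.* proj₂ a) ≡ a
  unit-weight (v , w) = cong (v ,_) (trans (cong (Q._* w) (QP.*-identityˡ 1ℚ)) (QP.*-identityˡ w))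

convδ-progression : ∀ m n → convδ m n ≡ map (weighted (n + m * suc n)) (progression ∣ m - n ∣ (suc (m ⊓ n)))
convδ-progression m n = begin
  map (weighted B ∘ step) (applyUpTo (λ k → k) (suc (m ⊓ n))) ≡⟨ map-applyUpTo (weighted B ∘ step) (λ k → k) _ ⟩
  applyUpTo (weighted B ∘ step) (suc (m ⊓ n))                  ≡⟨ sym (map-applyUpTo (weighted B) step _) ⟩
  map (weighted B) (applyUpTo step (suc (m ⊓ n)))             ≡⟨ cong (map (weighted B)) (applyUpTo-progression step _ _ (λ _ → refl)) ⟩
  map (weighted B) (progression ∣ m - n ∣ (suc (m ⊓ n)))      ∎
  where
  open ≡-Reasoning
  B = n + m * suc n
  step : ℕ → ℕ
  step k = ∣ m - n ∣ + 2 * k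

∣m-n∣+m⊓n≡m⊔n : ∀ m n → ∣ m - n ∣ + m ⊓ n ≡ m ⊔ n
∣m-n∣+m⊓n≡m⊔n m n with ≤-total m n
... | inj₁ m≤n rewrite m≤n⇒∣m-n∣≡n∸m m≤n | m≤n⇒m⊓n≡m m≤n | m≤n⇒m⊔n≡n m≤n = m∸n+n≡m m≤n
... | inj₂ n≤m rewrite m≤n⇒∣n-m∣≡n∸m n≤m | m≥n⇒m⊓n≡n n≤m | m≥n⇒m⊔n≡m n≤m = m∸n+n≡m n≤m

[1+m⊓n]*[1+m⊔n] : ∀ m n → suc (m ⊓ n) * suc (m ⊔ n) ≡ suc m * suc n
[1+m⊓n]*[1+m⊔n] m n with ≤-total m n
... | inj₁ m≤n rewrite m≤n⇒m⊓n≡m m≤n | m≤n⇒m⊔n≡n m≤n = refl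
... | inj₂ n≤m rewrite m≥n⇒m⊓n≡n n≤m | m≥n⇒m⊔n≡m n≤m = *-comm (suc n) (suc m)

-- An injective sequence in ℕ takes a value ≥ K at some index ≥ j
-- (pigeonhole: K+1 distinct values cannot all lie below K).
injective⇒unbounded : ∀ {x : ℕ → ℕ} → Injective _≡_ _≡_ x → ∀ K j → ∃ λ b → j ≤ b × K ≤ x b
injective⇒unbounded {x} inj K j with any? (λ (k : Fin (suc K)) → K ≤? x (j + toℕ k))
... | yes (k , K≤x) = j + toℕ k , m≤m+n j (toℕ k) , K≤x
... | no none with pigeonhole (n<1+n K) (λ k → fromℕ< (≰⇒> (λ K≤x → none (k , K≤x))))
...   | k₁ , k₂ , k₁<k₂ , same =
  ⊥-elim (<⇒≢ k₁<k₂ (+-cancelˡ-≡ j (toℕ k₁) (toℕ k₂) (inj (fromℕ<-injective _ _ _ _ same))))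

pair-mass≤ : ∀ N (i : Fin (4 * suc N)) m n → 4 * suc N ≤ m → 4 * suc N ≤ n →
             Q.toℚᵘ (massIn (δ m ⋆ δ n) (halfResidue (4 * suc N)) i) U.≤ mkℚᵘ (+ 1) N
pair-mass≤ N i m n P≤m P≤n = UP.≤-respˡ-≃ (UP.≃-sym mass≡) (fraction-≤ hits≤)
  where
  P = 4 * suc N
  s = m ⊓ n
  L = m ⊔ n
  d = ∣ m - n ∣
  open ColourClass (halfResidue P) i
  h = hitSum (progression d (suc s))

  mass≡ : Q.toℚᵘ (massIn (δ m ⋆ δ n) (halfResidue P) i) U.≃ mkℚᵘ (+ h) (n + m * suc n)
  mass≡ = subst (λ μ → Q.toℚᵘ (massIn μ (halfResidue P) i) U.≃ mkℚᵘ (+ h) (n + m * suc n))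
            (sym (trans (δ-⋆-δ m n) (convδ-progression m n))) (mass-weighted (n + m * suc n) (progression d (suc s)))

  -- s ≥ P, so the number of blocks is at most 2(s+1)/P …
  blocks≤ : suc s + P ≤ 2 * suc s
  blocks≤ = ≤-trans (+-monoʳ-≤ (suc s) (≤-trans (⊓-glb P≤m P≤n) (n≤1+n s))) (≤-reflexive (double (suc s)))
    where
    double : ∀ a → a + a ≡ 2 * a
    double = solve-∀

  -- … and every point of the support lies below 2(max(m,n)+1).
  support≤ : d + 2 * suc s ≤ 2 * suc L
  support≤ = begin
    d + 2 * suc s   ≡⟨ split d s ⟩
    d + s + (s + 2) ≡⟨ cong (_+ (s + 2)) (∣m-n∣+m⊓n≡m⊔n m n) ⟩
    L + (s + 2)     ≤⟨ +-monoʳ-≤ L (+-monoˡ-≤ 2 (m⊓n≤m⊔n m n)) ⟩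
    L + (L + 2)     ≡⟨ double L ⟩
    2 * suc L       ∎
    where
    open ≤-Reasoning
    split : ∀ d s → d + 2 * suc s ≡ d + s + (s + 2)
    split = solve-∀
    double : ∀ L → L + (L + 2) ≡ 2 * suc L
    double = solve-∀

  hits≤ : h * suc N ≤ 1 * suc (n + m * suc n)
  hits≤ = *-cancelˡ-≤ 4 (begin
    4 * (h * suc N)                  ≡⟨ reorder h N ⟩
    P * h                            ≤⟨ Blocks.bound P (halfResidue-sparse P i) d (suc s) ⟩
    (suc s + P) * (d + 2 * suc s)    ≤⟨ *-mono-≤ blocks≤ support≤ ⟩
    (2 * suc s) * (2 * suc L)        ≡⟨ four s L ⟩
    4 * (suc s * suc L)              ≡⟨ cong (4 *_) ([1+m⊓n]*[1+m⊔n] m n) ⟩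
    4 * (suc m * suc n)              ≡⟨ cong (4 *_) (sym (*-identityˡ (suc m * suc n))) ⟩
    4 * (1 * suc (n + m * suc n))    ∎)
    where
    open ≤-Reasoning
    reorder : ∀ h N → 4 * (h * suc N) ≡ 4 * suc N * h
    reorder = solve-∀
    four : ∀ s L → (2 * suc s) * (2 * suc L) ≡ 4 * (suc s * suc L)
    four = solve-∀

theorem4p5 : (α : ℚ) → 0ℚ < α → α < 1ℚ → ¬ IsRamsey α
theorem4p5 (Q.mkℚ (+ zero)   _ _) (Q.*<* (ℤ.+<+ ())) _ _
theorem4p5 (Q.mkℚ -[1+ _ ]   _ _) (Q.*<* ())         _ _
theorem4p5 α@(Q.mkℚ (+ suc k) N _) _ _ ramsey
  with ramsey (4 * suc N) (halfResidue (4 * suc N))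
... | i , x , x-injective , _ , exceeds
  with injective⇒unbounded x-injective (4 * suc N) 0
... | a , _ , P≤xa
  with injective⇒unbounded x-injective (4 * suc N) (suc a)
... | b , a<b , P≤xb = QP.<-irrefl refl (QP.<-≤-trans (exceeds a (b ∷ []) (a<b ∷ [-])) mass≤α)
  where
  -- δ_F(C_i) ≤ 1/(N+1) ≤ (k+1)/(N+1) = α for F = {x_a, x_b}.
  mass≤α : massIn (δF x a (b ∷ [])) (halfResidue (4 * suc N)) i Q.≤ α
  mass≤α = QP.toℚᵘ-cancel-≤ (UP.≤-trans (pair-mass≤ N i (x a) (x b) P≤xa P≤xb)
                                          (fraction-≤ (*-monoˡ-≤ (suc N) (s≤s (z≤n {k})))))
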